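{- $(T^*,\sigma)$ is irreducible: for all $t,t'\in T^*$ there exists $k\in\mathbb{N}$ such that $t'$ appears in $\sigma^k(t)$.
   Context: Let $p$ be an odd prime and $\mathbb{F}_p$ the field with $p$ elements. A tile is a unit equilateral triangle of the standard triangular lattice in the plane, oriented upward or downward, whose three corners are decorated with elements of $\mathbb{F}_p$. $\triangle(x,y,z)$ denotes the upward tile whose bottom-left, bottom-right and top corners carry $x,y,z$ respectively; $\triangledown(x,y,z)$ denotes the downward tile whose top-right, top-left and bottom corners carry $x,y,z$ respectively. $T$ is the set of all such decorated oriented tiles (up to translation), and $T^*=T\setminus\{\triangle(0,0,0),\triangledown(0,0,0)\}$. The substitution $\sigma$ inflates a tile by the factor $2$ and replaces it by four unit tiles: $\sigma(\triangle(x,y,z))$ consists of the bottom-left tile $\triangle(x,x+y,x+z)$, the bottom-right tile $\triangle(x+y,y,y+z)$, the top tile $\triangle(x+z,y+z,z)$ and the central tile $\triangledown(y+z,x+z,x+y)$; $\sigma(\triangledown(x,y,z))$ consists of the top-right tile $\triangledown(x,x+y,x+z)$, the top-left tile $\triangledown(x+y,y,y+z)$, the bottom tile $\triangledown(x+z,y+z,z)$ and the central tile $\triangle(y+z,x+z,x+y)$. $\sigma$ is applied to a patch by applying it to every tile (with inflation by $2$ about a fixed point). $\sigma^k(t)$, a $k$-supertile, is an equilateral triangle of side $2^k$ made of $4^k$ decorated unit tiles. A tile $t'$ appears in $\sigma^k(t)$ if one of these $4^k$ tiles equals $t'$ (same orientation and same decorations). -}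

module Defs where

open import Data.Nat using (ℕ; zero; suc; _+_; NonZero)
open import Data.Nat.DivMod using (_mod_)
open import Data.Fin using (Fin; toℕ; fromℕ<)
open import Data.List using (List; []; _∷_; concatMap)
open import Data.Product using (_×_; _,_; Σ)
open import Data.Nat.Primality using (Prime)
open import Data.Nat.Divisibility using (_∣_)
open import Relation.Nullary using (¬_)
open import Relation.Binary.PropositionalEquality using (_≡_)

OddPrime : ℕ → Set
OddPrime p = Prime p × ¬ (2 ∣ p)

-- The field F_p, represented as Fin p with addition modulo p.
-- (Only addition is needed by the substitution.)
module Field (p : ℕ) .{{_ : NonZero p}} where

  𝔽 : Set
  𝔽 = Fin p

  _⊕_ : 𝔽 → 𝔽 → 𝔽
  a ⊕ b = (toℕ a + toℕ b) mod p

  0𝔽 : 𝔽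
  0𝔽 = 0 mod p

  infixl 6 _⊕_

  data Orient : Set where
    up down : Orient

  -- A decorated tile (up to translation): orientation and the three corner labels.
  -- up   x y z : bottom-left, bottom-right, top
  -- down x y z : top-right, top-left, bottom
  data Tile : Set where
    tile : Orient → 𝔽 → 𝔽 → 𝔽 → Tile

  InTStar : Tile → Set
  InTStar (tile o x y z) = ¬ ((x ≡ 0𝔽) × (y ≡ 0𝔽) × (z ≡ 0𝔽))

  -- The four unit tiles of σ(t) (positions are irrelevant for "appears in").
  σ : Tile → List Tile
  σ (tile up x y z) =
    tile up (x) (x ⊕ y) (x ⊕ z) ∷
    tile up (x ⊕ y) y (y ⊕ z) ∷
    tile up (x ⊕ z) (y ⊕ z) z ∷
    tile down (y ⊕ z) (x ⊕ z) (x ⊕ y) ∷ []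
  σ (tile down x y z) =
    tile down x (x ⊕ y) (x ⊕ z) ∷
    tile down (x ⊕ y) y (y ⊕ z) ∷
    tile down (x ⊕ z) (y ⊕ z) z ∷
    tile up (y ⊕ z) (x ⊕ z) (x ⊕ y) ∷ []

  σ^ : ℕ → Tile → List Tile
  σ^ zero t = t ∷ []
  σ^ (suc k) t = concatMap σ (σ^ k t)

-- The three corner children of σ(t) are t with one corner label added to the other two
-- (a shear). Iterating, one may add any multiple of that label, hence any element of 𝔽ₚ
-- when the label is nonzero. A shear has order p, so the reachability these moves generate
-- on label triples is symmetric, and a normal-form argument (halving, which needs p odd)
-- connects every nonzero triple to e₁ = (1,0,0). The central child of a tile labelled e₁
-- has the opposite orientation and the nonzero labels (0,1,1), which links the two
-- orientations.

module Submission where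

open import Defs
open import Data.Nat using (ℕ; NonZero)
open import Data.Product using (Σ)
open import Data.List.Membership.Propositional using (_∈_)

open import Algebra.Bundles using (AbelianGroup)
open import Algebra.Structures using (IsAbelianGroup; IsCommutativeMonoid)
open import Algebra.Structures.Biased using (isCommutativeMonoidˡ)
open import Data.Empty using (⊥-elim)
open import Data.Fin using (toℕ) renaming (_≟_ to _≟𝔽_)
open import Data.Fin.Properties using (toℕ-injective; toℕ-fromℕ<; toℕ<n)
open import Data.List.Membership.Propositional.Properties using (∈-++⁺ˡ)
open import Data.List.Relation.Binary.Subset.Propositional using (_⊆_)
open import Data.List.Relation.Binary.Subset.Propositional.Properties using (concatMap⁺)
open import Data.List.Relation.Unary.Any using (here; there)
open import Data.Nat using (zero; suc; _+_; _*_; _∸_; _%_; _<_; z<s; pred; ≢-nonZero; >-nonZero⁻¹; nonTrivial⇒n>1)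
open import Data.Nat.Coprimality using (prime⇒coprime; coprime-Bézout)
open import Data.Nat.Divisibility using (_∣_; ∣-refl)
open import Data.Nat.DivMod using (_mod_; m%n<n; m<n⇒m%n≡m; %-distribˡ-+; n%n≡0; m*n%n≡0; [m+n]%n≡m%n; [m+kn]%n≡m%n)
open import Data.Nat.GCD using (module Bézout)
open import Data.Nat.Primality using (Prime; prime⇒nonTrivial)
open import Data.Nat.Properties using (+-comm; +-assoc; *-assoc; *-comm; *-identityʳ; m+[n∸m]≡n; <⇒≤; <⇒≢; ≤∧≢⇒<; suc-pred)
open import Data.Nat.Tactic.RingSolver using (solve-∀)
open import Data.Product using (∃-syntax; _,_; _×_)
open import Level using (0ℓ)
open import Relation.Binary.Construct.Closure.ReflexiveTransitive using (Star; ε; _◅_; _◅◅_; reverse)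
open import Relation.Binary.Construct.Closure.ReflexiveTransitive.Properties using (module StarReasoning)
open import Relation.Binary.PropositionalEquality
  using (_≡_; _≢_; refl; sym; trans; cong; cong₂; subst; module ≡-Reasoning)
open import Relation.Binary.PropositionalEquality.Algebra using (isMagma)
open import Relation.Nullary using (¬_; yes; no)

module Residues (p : ℕ) .{{_ : NonZero p}} where
  open Field p
  open ≡-Reasoning

  [_] : ℕ → 𝔽
  [ m ] = m mod p

  1𝔽 : 𝔽
  1𝔽 = [ 1 ]

  0%p≡0 : 0 % p ≡ 0
  0%p≡0 = m<n⇒m%n≡m (>-nonZero⁻¹ p)

  toℕ-[] : ∀ m → toℕ [ m ] ≡ m % p
  toℕ-[] m = toℕ-fromℕ< (m%n<n m p)

  []-cong : ∀ {m n} → m % p ≡ n % p → [ m ] ≡ [ n ]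
  []-cong {m} {n} eq = toℕ-injective (trans (toℕ-[] m) (trans eq (sym (toℕ-[] n))))

  []-toℕ : ∀ x → [ toℕ x ] ≡ x
  []-toℕ x = toℕ-injective (trans (toℕ-[] (toℕ x)) (m<n⇒m%n≡m (toℕ<n x)))

  []-+ : ∀ m n → [ m + n ] ≡ [ m ] ⊕ [ n ]
  []-+ m n = []-cong (trans (%-distribˡ-+ m n p) (sym (cong₂ (λ a b → (a + b) % p) (toℕ-[] m) (toℕ-[] n))))

  [p]≡0𝔽 : [ p ] ≡ 0𝔽
  [p]≡0𝔽 = []-cong (trans (n%n≡0 p) (sym 0%p≡0))

  []≢0𝔽 : ∀ {m} → 0 < m → m < p → [ m ] ≢ 0𝔽
  []≢0𝔽 {m} 0<m m<p [m]≡0𝔽 = <⇒≢ 0<m (sym (begin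
    m         ≡⟨ m<n⇒m%n≡m m<p ⟨
    m % p     ≡⟨ toℕ-[] m ⟨
    toℕ [ m ] ≡⟨ cong toℕ [m]≡0𝔽 ⟩
    toℕ 0𝔽    ≡⟨ toℕ-[] 0 ⟩
    0 % p     ≡⟨ 0%p≡0 ⟩
    0         ∎))

  toℕ-≢0 : ∀ {x} → x ≢ 0𝔽 → toℕ x ≢ 0
  toℕ-≢0 {x} x≢0 toℕx≡0 = x≢0 (trans (sym ([]-toℕ x)) (cong [_] toℕx≡0))

  -_ : 𝔽 → 𝔽
  - x = [ p ∸ toℕ x ]

  ⊕-comm : ∀ x y → x ⊕ y ≡ y ⊕ x
  ⊕-comm x y = cong [_] (+-comm (toℕ x) (toℕ y))

  ⊕-assoc : ∀ x y z → (x ⊕ y) ⊕ z ≡ x ⊕ (y ⊕ z)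
  ⊕-assoc x y z = begin
    (x ⊕ y) ⊕ z                   ≡⟨ cong ((x ⊕ y) ⊕_) ([]-toℕ z) ⟨
    [ toℕ x + toℕ y ] ⊕ [ toℕ z ]  ≡⟨ []-+ (toℕ x + toℕ y) (toℕ z) ⟨
    [ toℕ x + toℕ y + toℕ z ]      ≡⟨ cong [_] (+-assoc (toℕ x) (toℕ y) (toℕ z)) ⟩
    [ toℕ x + (toℕ y + toℕ z) ]    ≡⟨ []-+ (toℕ x) (toℕ y + toℕ z) ⟩
    [ toℕ x ] ⊕ (y ⊕ z)            ≡⟨ cong (_⊕ (y ⊕ z)) ([]-toℕ x) ⟩
    x ⊕ (y ⊕ z)                    ∎

  ⊕-identityˡ : ∀ x → 0𝔽 ⊕ x ≡ x
  ⊕-identityˡ x = begin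
    0𝔽 ⊕ x            ≡⟨ cong (0𝔽 ⊕_) ([]-toℕ x) ⟨
    [ 0 ] ⊕ [ toℕ x ] ≡⟨ []-+ 0 (toℕ x) ⟨
    [ toℕ x ]         ≡⟨ []-toℕ x ⟩
    x                 ∎

  ⊕-inverseʳ : ∀ x → x ⊕ - x ≡ 0𝔽
  ⊕-inverseʳ x = begin
    x ⊕ - x                   ≡⟨ cong (_⊕ - x) ([]-toℕ x) ⟨
    [ toℕ x ] ⊕ [ p ∸ toℕ x ] ≡⟨ []-+ (toℕ x) (p ∸ toℕ x) ⟨
    [ toℕ x + (p ∸ toℕ x) ]   ≡⟨ cong [_] (m+[n∸m]≡n (<⇒≤ (toℕ<n x))) ⟩
    [ p ]                     ≡⟨ [p]≡0𝔽 ⟩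
    0𝔽                        ∎

  ⊕-isAbelianGroup : IsAbelianGroup _≡_ _⊕_ 0𝔽 -_
  ⊕-isAbelianGroup = record
    { isGroup = record
      { isMonoid = IsCommutativeMonoid.isMonoid (isCommutativeMonoidˡ record
        { isSemigroup = record { isMagma = isMagma _⊕_ ; assoc = ⊕-assoc }
        ; identityˡ   = ⊕-identityˡ
        ; comm        = ⊕-comm
        })
      ; inverse = (λ x → trans (⊕-comm (- x) x) (⊕-inverseʳ x)) , ⊕-inverseʳ
      ; ⁻¹-cong = cong -_
      }
    ; comm = ⊕-comm
    }

  ⊕-abelianGroup : AbelianGroup 0ℓ 0ℓ
  ⊕-abelianGroup = record { isAbelianGroup = ⊕-isAbelianGroup }

  open AbelianGroup ⊕-abelianGroup public using (identityʳ; inverseˡ)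
  open AbelianGroup ⊕-abelianGroup using (group; commutativeSemigroup; commutativeMonoid)
  open import Algebra.Properties.Group group public using (∙-cancelˡ; //-rightDividesˡ)
  open import Algebra.Properties.CommutativeSemigroup commutativeSemigroup public using (interchange; x∙yz≈y∙xz)
  open import Algebra.Properties.CommutativeMonoid.Mult commutativeMonoid public
    using (×-homo-1; ×-homo-+; ×-assocˡ; ×-distrib-+) renaming (_×_ to _·_)

  x≢0∧y≡0⇒x⊕y≢0 : ∀ {x y} → x ≢ 0𝔽 → y ≡ 0𝔽 → x ⊕ y ≢ 0𝔽
  x≢0∧y≡0⇒x⊕y≢0 {x} x≢0 y≡0 = subst (_≢ 0𝔽) (sym (trans (cong (x ⊕_) y≡0) (identityʳ x))) x≢0

  ·-[] : ∀ n m → n · [ m ] ≡ [ n * m ]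
  ·-[] zero    m = refl
  ·-[] (suc n) m = trans (cong ([ m ] ⊕_) (·-[] n m)) (sym ([]-+ m (n * m)))

  ·-toℕ : ∀ n x → n · x ≡ [ n * toℕ x ]
  ·-toℕ n x = trans (cong (n ·_) (sym ([]-toℕ x))) (·-[] n (toℕ x))

  [k*p]·x≡0𝔽 : ∀ k x → (k * p) · x ≡ 0𝔽
  [k*p]·x≡0𝔽 k x = begin
    (k * p) · x          ≡⟨ ·-toℕ (k * p) x ⟩
    [ k * p * toℕ x ]    ≡⟨ cong [_] (*-assoc k p (toℕ x)) ⟩
    [ k * (p * toℕ x) ]  ≡⟨ cong (λ m → [ k * m ]) (*-comm p (toℕ x)) ⟩
    [ k * (toℕ x * p) ]  ≡⟨ cong [_] (*-assoc k (toℕ x) p) ⟨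
    [ k * toℕ x * p ]    ≡⟨ []-cong (trans (m*n%n≡0 (k * toℕ x) p) (sym 0%p≡0)) ⟩
    0𝔽                   ∎

  module _ (p-prime : Prime p) where

    -- Bézout gives y · c ≡ 1 or y · c ≡ -1; in the second case (p - 1) * y is the inverse.
    ·-inverse : ∀ {c} → c ≢ 0𝔽 → ∃[ u ] u · c ≡ 1𝔽
    ·-inverse {c} c≢0 with coprime-Bézout (prime⇒coprime p-prime {{≢-nonZero (toℕ-≢0 c≢0)}} (toℕ<n c))
    ... | Bézout.-+ x y 1+xp≡yc = y , (begin
      y · c          ≡⟨ ·-toℕ y c ⟩
      [ y * toℕ c ]  ≡⟨ cong [_] 1+xp≡yc ⟨
      [ 1 + x * p ]  ≡⟨ []-cong ([m+kn]%n≡m%n 1 x p) ⟩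
      1𝔽             ∎)
    ... | Bézout.+- x y 1+yc≡xp = q * y , (begin
      (q * y) · c            ≡⟨ ·-toℕ (q * y) c ⟩
      [ q * y * toℕ c ]      ≡⟨ []-cong ([m+n]%n≡m%n (q * y * toℕ c) p) ⟨
      [ q * y * toℕ c + p ]  ≡⟨ cong [_] qyc+p≡1+qxp ⟩
      [ 1 + q * x * p ]      ≡⟨ []-cong ([m+kn]%n≡m%n 1 (q * x) p) ⟩
      1𝔽                     ∎)
      where
      q = pred p
      qyc+p≡1+qxp : q * y * toℕ c + p ≡ 1 + q * x * p
      qyc+p≡1+qxp = begin
        q * y * toℕ c + p        ≡⟨ cong (q * y * toℕ c +_) (suc-pred p) ⟨
        q * y * toℕ c + suc q    ≡⟨ rearrange q y (toℕ c) ⟩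
        1 + q * (1 + y * toℕ c)  ≡⟨ cong (λ m → 1 + q * m) 1+yc≡xp ⟩
        1 + q * (x * p)          ≡⟨ cong (1 +_) (*-assoc q x p) ⟨
        1 + q * x * p            ∎
        where
        rearrange : ∀ a b c → a * b * c + suc a ≡ 1 + a * (1 + b * c)
        rearrange = solve-∀

    ·-surjective : ∀ {c} → c ≢ 0𝔽 → ∀ r → ∃[ n ] n · c ≡ r
    ·-surjective {c} c≢0 r with u , u·c≡1 ← ·-inverse c≢0 = toℕ r * u , (begin
      (toℕ r * u) · c  ≡⟨ ×-assocˡ c (toℕ r) u ⟨
      toℕ r · (u · c)  ≡⟨ cong (toℕ r ·_) u·c≡1 ⟩
      toℕ r · 1𝔽       ≡⟨ ·-[] (toℕ r) 1 ⟩
      [ toℕ r * 1 ]    ≡⟨ cong [_] (*-identityʳ (toℕ r)) ⟩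
      [ toℕ r ]        ≡⟨ []-toℕ r ⟩
      r                ∎)

    halve : 1𝔽 ⊕ 1𝔽 ≢ 0𝔽 → ∀ d → ∃[ w ] w ⊕ w ≡ d
    halve 2≢0 d with n , n·2≡d ← ·-surjective 2≢0 d =
      n · 1𝔽 , trans (sym (×-distrib-+ 1𝔽 1𝔽 n)) n·2≡d

module Shears (p : ℕ) .{{_ : NonZero p}} where
  open Field p
  open Residues p
  open ≡-Reasoning

  V : Set
  V = 𝔽 × 𝔽 × 𝔽

  data Axis : Set where
    X Y Z : Axis

  shear : Axis → V → V
  shear X (x , y , z) = x , x ⊕ y , x ⊕ z
  shear Y (x , y , z) = x ⊕ y , y , y ⊕ z
  shear Z (x , y , z) = x ⊕ z , y ⊕ z , z

  pivot : Axis → V → 𝔽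
  pivot X (x , _ , _) = x
  pivot Y (_ , y , _) = y
  pivot Z (_ , _ , z) = z

  translate : Axis → 𝔽 → V → V
  translate X w (x , y , z) = x , w ⊕ y , w ⊕ z
  translate Y w (x , y , z) = w ⊕ x , y , w ⊕ z
  translate Z w (x , y , z) = w ⊕ x , w ⊕ y , z

  shear^ : Axis → ℕ → V → V
  shear^ a n v = translate a (n · pivot a v) v

  pivot-translate : ∀ a w v → pivot a (translate a w v) ≡ pivot a v
  pivot-translate X w (x , y , z) = refl
  pivot-translate Y w (x , y , z) = refl
  pivot-translate Z w (x , y , z) = refl

  translate-pivot : ∀ a v → translate a (pivot a v) v ≡ shear a v
  translate-pivot X (x , y , z) = refl
  translate-pivot Y (x , y , z) = cong (_, y , y ⊕ z) (⊕-comm y x)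
  translate-pivot Z (x , y , z) = cong₂ (λ u w → u , w , z) (⊕-comm z x) (⊕-comm z y)

  translate-0𝔽 : ∀ a v → translate a 0𝔽 v ≡ v
  translate-0𝔽 X (x , y , z) = cong₂ (λ u w → x , u , w) (⊕-identityˡ y) (⊕-identityˡ z)
  translate-0𝔽 Y (x , y , z) = cong₂ (λ u w → u , y , w) (⊕-identityˡ x) (⊕-identityˡ z)
  translate-0𝔽 Z (x , y , z) = cong₂ (λ u w → u , w , z) (⊕-identityˡ x) (⊕-identityˡ y)

  translate-⊕ : ∀ a w w′ v → translate a w (translate a w′ v) ≡ translate a (w ⊕ w′) v
  translate-⊕ X w w′ (x , y , z) = sym (cong₂ (λ u u′ → x , u , u′) (⊕-assoc w w′ y) (⊕-assoc w w′ z))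
  translate-⊕ Y w w′ (x , y , z) = sym (cong₂ (λ u u′ → u , y , u′) (⊕-assoc w w′ x) (⊕-assoc w w′ z))
  translate-⊕ Z w w′ (x , y , z) = sym (cong₂ (λ u u′ → u , u′ , z) (⊕-assoc w w′ x) (⊕-assoc w w′ y))

  shear^-+ : ∀ a m n v → shear^ a m (shear^ a n v) ≡ shear^ a (m + n) v
  shear^-+ a m n v = begin
    translate a (m · pivot a (shear^ a n v)) (shear^ a n v)
      ≡⟨ cong (λ c → translate a (m · c) (shear^ a n v)) (pivot-translate a (n · c) v) ⟩
    translate a (m · c) (translate a (n · c) v)  ≡⟨ translate-⊕ a (m · c) (n · c) v ⟩
    translate a (m · c ⊕ n · c) v                ≡⟨ cong (λ w → translate a w v) (×-homo-+ c m n) ⟨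
    shear^ a (m + n) v                           ∎
    where c = pivot a v

  shear^-1 : ∀ a v → shear^ a 1 v ≡ shear a v
  shear^-1 a v = trans (cong (λ w → translate a w v) (×-homo-1 (pivot a v))) (translate-pivot a v)

  shear^-[k*p] : ∀ a k v → shear^ a (k * p) v ≡ v
  shear^-[k*p] a k v = trans (cong (λ w → translate a w v) ([k*p]·x≡0𝔽 k (pivot a v))) (translate-0𝔽 a v)

  shear^-inverse : ∀ a n v → shear^ a (pred p * n) (shear^ a n v) ≡ v
  shear^-inverse a n v = begin
    shear^ a (pred p * n) (shear^ a n v)  ≡⟨ shear^-+ a (pred p * n) n v ⟩
    shear^ a (pred p * n + n) v           ≡⟨ cong (λ m → shear^ a m v) pred-p*n+n≡n*p ⟩
    shear^ a (n * p) v                    ≡⟨ shear^-[k*p] a n v ⟩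
    v                                     ∎
    where
    pred-p*n+n≡n*p : pred p * n + n ≡ n * p
    pred-p*n+n≡n*p = begin
      pred p * n + n    ≡⟨ +-comm (pred p * n) n ⟩
      suc (pred p) * n  ≡⟨ cong (_* n) (suc-pred p) ⟩
      p * n             ≡⟨ *-comm p n ⟩
      n * p             ∎

  data Step : V → V → Set where
    shearing : ∀ a n v → Step v (shear^ a n v)

  _↝_ : V → V → Set
  _↝_ = Star Step

  Step-sym : ∀ {v w} → Step v w → Step w v
  Step-sym (shearing a n v) = subst (Step _) (shear^-inverse a n v) (shearing a (pred p * n) _)

  ↝-sym : ∀ {v w} → v ↝ w → w ↝ v
  ↝-sym = reverse Step-sym

  Balanced : V → Set
  Balanced (x , y , z) = x ⊕ y ≡ 1𝔽 ⊕ z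

  balanced-translate-X : ∀ w {v} → Balanced v → Balanced (translate X w v)
  balanced-translate-X w {x , y , z} x⊕y≡1⊕z = begin
    x ⊕ (w ⊕ y)   ≡⟨ x∙yz≈y∙xz x w y ⟩
    w ⊕ (x ⊕ y)   ≡⟨ cong (w ⊕_) x⊕y≡1⊕z ⟩
    w ⊕ (1𝔽 ⊕ z)  ≡⟨ x∙yz≈y∙xz w 1𝔽 z ⟩
    1𝔽 ⊕ (w ⊕ z)  ∎

  balanced-translate-Y : ∀ w {v} → Balanced v → Balanced (translate Y w v)
  balanced-translate-Y w {x , y , z} x⊕y≡1⊕z = begin
    w ⊕ x ⊕ y     ≡⟨ ⊕-assoc w x y ⟩
    w ⊕ (x ⊕ y)   ≡⟨ cong (w ⊕_) x⊕y≡1⊕z ⟩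
    w ⊕ (1𝔽 ⊕ z)  ≡⟨ x∙yz≈y∙xz w 1𝔽 z ⟩
    1𝔽 ⊕ (w ⊕ z)  ∎

module Supertiles (p : ℕ) .{{_ : NonZero p}} where
  open Field p
  open Residues p
  open Shears p

  _⇝_ : Tile → Tile → Set
  t ⇝ t′ = ∃[ k ] t′ ∈ σ^ k t

  σ^-⊆ : ∀ {k t t′} l → t′ ∈ σ^ k t → σ^ l t′ ⊆ σ^ (l + k) t
  σ^-⊆ zero    t′∈ (here refl) = t′∈
  σ^-⊆ (suc l) t′∈             = concatMap⁺ σ (σ^-⊆ l t′∈)

  ⇝-refl : ∀ {t} → t ⇝ t
  ⇝-refl = 0 , here refl

  ⇝-trans : ∀ {t t′ t″} → t ⇝ t′ → t′ ⇝ t″ → t ⇝ t″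
  ⇝-trans (k , t′∈) (l , t″∈) = l + k , σ^-⊆ l t′∈ t″∈

  ∈σ⇒⇝ : ∀ {t t′} → t′ ∈ σ t → t ⇝ t′
  ∈σ⇒⇝ t′∈ = 1 , ∈-++⁺ˡ t′∈

  tileAt : Orient → V → Tile
  tileAt o (x , y , z) = tile o x y z

  shear-∈σ : ∀ o a v → tileAt o (shear a v) ∈ σ (tileAt o v)
  shear-∈σ up   X (x , y , z) = here refl
  shear-∈σ up   Y (x , y , z) = there (here refl)
  shear-∈σ up   Z (x , y , z) = there (there (here refl))
  shear-∈σ down X (x , y , z) = here refl
  shear-∈σ down Y (x , y , z) = there (here refl)
  shear-∈σ down Z (x , y , z) = there (there (here refl))

  opposite : Orient → Orient
  opposite up   = down
  opposite down = up

  centre : V → V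
  centre (x , y , z) = y ⊕ z , x ⊕ z , x ⊕ y

  centre-∈σ : ∀ o v → tileAt (opposite o) (centre v) ∈ σ (tileAt o v)
  centre-∈σ up   (x , y , z) = there (there (there (here refl)))
  centre-∈σ down (x , y , z) = there (there (there (here refl)))

  shear^-⇝ : ∀ o a n v → tileAt o v ⇝ tileAt o (shear^ a n v)
  shear^-⇝ o a zero    v = 0 , here (cong (tileAt o) (translate-0𝔽 a v))
  shear^-⇝ o a (suc n) v =
    subst (λ w → tileAt o v ⇝ tileAt o w) shear-shear^ (⇝-trans (shear^-⇝ o a n v) (∈σ⇒⇝ (shear-∈σ o a _)))
    where
    shear-shear^ : shear a (shear^ a n v) ≡ shear^ a (suc n) v
    shear-shear^ = trans (sym (shear^-1 a _)) (shear^-+ a 1 n v)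

  ↝⇒⇝ : ∀ o {v w} → v ↝ w → tileAt o v ⇝ tileAt o w
  ↝⇒⇝ o ε                        = ⇝-refl
  ↝⇒⇝ o (shearing a n v ◅ v′↝w) = ⇝-trans (shear^-⇝ o a n v) (↝⇒⇝ o v′↝w)

module Irreducibility (p : ℕ) .{{_ : NonZero p}} (p-prime : Prime p) (2<p : 2 < p) where
  open Field p
  open Residues p
  open Shears p
  open Supertiles p
  open StarReasoning Step

  1𝔽≢0𝔽 : 1𝔽 ≢ 0𝔽
  1𝔽≢0𝔽 = []≢0𝔽 z<s (<⇒≤ 2<p)

  1𝔽⊕1𝔽≢0𝔽 : 1𝔽 ⊕ 1𝔽 ≢ 0𝔽
  1𝔽⊕1𝔽≢0𝔽 = subst (_≢ 0𝔽) ([]-+ 1 1) ([]≢0𝔽 z<s 2<p)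

  translate-↝ : ∀ a {v} → pivot a v ≢ 0𝔽 → ∀ w → v ↝ translate a w v
  translate-↝ a {v} pivot≢0 w with n , n·pivot≡w ← ·-surjective p-prime pivot≢0 w =
    subst (λ u → v ↝ translate a u v) n·pivot≡w (shearing a n v ◅ ε)

  e₁ : V
  e₁ = 1𝔽 , 0𝔽 , 0𝔽

  -- On the plane x ⊕ y = 1 ⊕ z, a Y-translation making x = 1 forces z = y,
  -- which an X-translation then clears.
  balanced∧second≢0𝔽⇒↝e₁ : ∀ {a b c} → b ≢ 0𝔽 → Balanced (a , b , c) → (a , b , c) ↝ e₁
  balanced∧second≢0𝔽⇒↝e₁ {a} {b} {c} b≢0 balanced = begin
    (a , b , c)                  ⟶*⟨ translate-↝ Y b≢0 w ⟩
    (w ⊕ a , b , w ⊕ c)          ≡⟨ cong₂ (λ u u′ → u , b , u′) w⊕a≡1𝔽 w⊕c≡b ⟩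
    (1𝔽 , b , b)                 ⟶*⟨ translate-↝ X 1𝔽≢0𝔽 (- b) ⟩
    (1𝔽 , - b ⊕ b , - b ⊕ b)     ≡⟨ cong₂ (λ u u′ → 1𝔽 , u , u′) (inverseˡ b) (inverseˡ b) ⟩
    e₁                           ∎
    where
    w = 1𝔽 ⊕ - a
    w⊕a≡1𝔽 : w ⊕ a ≡ 1𝔽
    w⊕a≡1𝔽 = //-rightDividesˡ a 1𝔽
    w⊕c≡b : w ⊕ c ≡ b
    w⊕c≡b = ∙-cancelˡ 1𝔽 (w ⊕ c) b
      (trans (sym (balanced-translate-Y w balanced)) (cong (_⊕ b) w⊕a≡1𝔽))

  balanced⇒↝e₁ : ∀ {a b c} → ¬ (a ≡ 0𝔽 × b ≡ 0𝔽) → Balanced (a , b , c) → (a , b , c) ↝ e₁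
  balanced⇒↝e₁ {a} {b} ab≢0 balanced with b ≟𝔽 0𝔽
  ... | no  b≢0 = balanced∧second≢0𝔽⇒↝e₁ b≢0 balanced
  ... | yes b≡0 = translate-↝ X a≢0 a ◅◅
    balanced∧second≢0𝔽⇒↝e₁ (x≢0∧y≡0⇒x⊕y≢0 a≢0 b≡0) (balanced-translate-X a balanced)
    where
    a≢0 : a ≢ 0𝔽
    a≢0 a≡0 = ab≢0 (a≡0 , b≡0)

  -- A Z-translation by w adds w ⊕ w to x ⊕ y; with z = 1 the translated pair sums to
  -- 1 ⊕ 1 ≢ 0, so it is not (0, 0).
  third≡1𝔽⇒↝e₁ : ∀ x y → (x , y , 1𝔽) ↝ e₁
  third≡1𝔽⇒↝e₁ x y with w , w⊕w≡2-x-y ← halve p-prime 1𝔽⊕1𝔽≢0𝔽 ((1𝔽 ⊕ 1𝔽) ⊕ - (x ⊕ y)) =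
    translate-↝ Z 1𝔽≢0𝔽 w ◅◅ balanced⇒↝e₁ not-both-0𝔽 balanced
    where
    balanced : Balanced (w ⊕ x , w ⊕ y , 1𝔽)
    balanced = trans (interchange w x w y)
      (trans (cong (_⊕ (x ⊕ y)) w⊕w≡2-x-y) (//-rightDividesˡ (x ⊕ y) (1𝔽 ⊕ 1𝔽)))
    not-both-0𝔽 : ¬ (w ⊕ x ≡ 0𝔽 × w ⊕ y ≡ 0𝔽)
    not-both-0𝔽 (w⊕x≡0 , w⊕y≡0) =
      1𝔽⊕1𝔽≢0𝔽 (trans (sym balanced) (trans (cong₂ _⊕_ w⊕x≡0 w⊕y≡0) (identityʳ 0𝔽)))

  first≢0𝔽⇒↝e₁ : ∀ {x y z} → x ≢ 0𝔽 → (x , y , z) ↝ e₁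
  first≢0𝔽⇒↝e₁ {x} {y} {z} x≢0 = begin
    (x , y , z)          ⟶*⟨ translate-↝ X x≢0 w ⟩
    (x , w ⊕ y , w ⊕ z)  ≡⟨ cong (λ u → x , w ⊕ y , u) (//-rightDividesˡ z 1𝔽) ⟩
    (x , w ⊕ y , 1𝔽)     ⟶*⟨ third≡1𝔽⇒↝e₁ x (w ⊕ y) ⟩
    e₁                   ∎
    where w = 1𝔽 ⊕ - z

  nonzero⇒↝e₁ : ∀ {x y z} → ¬ (x ≡ 0𝔽 × y ≡ 0𝔽 × z ≡ 0𝔽) → (x , y , z) ↝ e₁
  nonzero⇒↝e₁ {x} {y} {z} v≢0 with x ≟𝔽 0𝔽 | y ≟𝔽 0𝔽 | z ≟𝔽 0𝔽
  ... | no x≢0  | _       | _       = first≢0𝔽⇒↝e₁ x≢0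
  ... | yes x≡0 | no y≢0  | _       = translate-↝ Y y≢0 y ◅◅ first≢0𝔽⇒↝e₁ (x≢0∧y≡0⇒x⊕y≢0 y≢0 x≡0)
  ... | yes x≡0 | yes y≡0 | no z≢0  = translate-↝ Z z≢0 z ◅◅ first≢0𝔽⇒↝e₁ (x≢0∧y≡0⇒x⊕y≢0 z≢0 x≡0)
  ... | yes x≡0 | yes y≡0 | yes z≡0 = ⊥-elim (v≢0 (x≡0 , y≡0 , z≡0))

  e₁⇝opposite : ∀ o → tileAt o e₁ ⇝ tileAt (opposite o) e₁
  e₁⇝opposite o = ⇝-trans (∈σ⇒⇝ (centre-∈σ o e₁)) (↝⇒⇝ (opposite o) (nonzero⇒↝e₁ centre-e₁≢0))
    where
    centre-e₁≢0 : ¬ (0𝔽 ⊕ 0𝔽 ≡ 0𝔽 × 1𝔽 ⊕ 0𝔽 ≡ 0𝔽 × 1𝔽 ⊕ 0𝔽 ≡ 0𝔽)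
    centre-e₁≢0 (_ , 1𝔽⊕0𝔽≡0𝔽 , _) = 1𝔽≢0𝔽 (trans (sym (identityʳ 1𝔽)) 1𝔽⊕0𝔽≡0𝔽)

  e₁⇝e₁ : ∀ o o′ → tileAt o e₁ ⇝ tileAt o′ e₁
  e₁⇝e₁ up   up   = ⇝-refl
  e₁⇝e₁ up   down = e₁⇝opposite up
  e₁⇝e₁ down up   = e₁⇝opposite down
  e₁⇝e₁ down down = ⇝-refl

  irreducible : ∀ t t′ → InTStar t → InTStar t′ → t ⇝ t′
  irreducible (tile o x y z) (tile o′ x′ y′ z′) v≢0 v′≢0 =
    ⇝-trans (↝⇒⇝ o (nonzero⇒↝e₁ v≢0)) (⇝-trans (e₁⇝e₁ o o′) (↝⇒⇝ o′ (↝-sym (nonzero⇒↝e₁ v′≢0))))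

oddPrime⇒2<p : ∀ {p} → OddPrime p → 2 < p
oddPrime⇒2<p {p} (p-prime , 2∤p) =
  ≤∧≢⇒< (nonTrivial⇒n>1 p {{prime⇒nonTrivial p-prime}}) (λ 2≡p → 2∤p (subst (2 ∣_) 2≡p ∣-refl))

mainTheorem1 : (p : ℕ) .{{_ : NonZero p}} → OddPrime p →
    (t t′ : Field.Tile p) → Field.InTStar p t → Field.InTStar p t′ →
    Σ ℕ (λ k → t′ ∈ Field.σ^ p k t)
mainTheorem1 p oddPrime@(p-prime , _) = Irreducibility.irreducible p p-prime (oddPrime⇒2<p oddPrime)
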